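{- Let $G=(S\cup K,E)$ be a split graph, where $S$ is an independent set and $K$ is a clique of $G$, and assume $K$ is a maximum clique, i.e. $\omega(G)=|K|$. Then $D(G)=Tr(G)$.
   Context: All graphs are finite and simple. A split graph is a graph whose vertex set can be partitioned into an independent set $S$ and a clique $K$. $\omega(G)$ is the clique number. For disjoint vertex sets $A,B$, $A$ dominates $B$ if every vertex of $B$ is adjacent to at least one vertex of $A$. A transitive $k$-partition is a partition of $V(G)$ into $k$ nonempty parts $V_1,\dots,V_k$ with $V_i$ dominating $V_j$ for all $1\le i<j\le k$; the transitivity $Tr(G)$ is the maximum such $k$. An upper domatic partition of size $k$ is a partition of $V(G)$ into $k$ nonempty parts such that for any two parts $V_i,V_j$, $V_i$ dominates $V_j$ or $V_j$ dominates $V_i$ (or both); the upper domatic number $D(G)$ is the maximum such $k$. -}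

module Defs where

open import Data.Nat using (ℕ; _≤_; _<_)
open import Data.Bool using (Bool; true; false; T)
open import Data.Fin using (Fin) renaming (_<_ to _<ᶠ_)
open import Data.Fin.Subset using (Subset; _∈_; _∉_; ∣_∣)
open import Data.Product using (Σ; ∃; _×_; _,_)
open import Data.Sum using (_⊎_)
open import Relation.Binary.PropositionalEquality using (_≡_; _≢_)
open import Relation.Nullary using (¬_)
open import Function.Definitions using (Surjective)

record Graph (n : ℕ) : Set where
  field
    adj    : Fin n → Fin n → Bool
    sym    : ∀ u v → adj u v ≡ adj v u
    irrefl : ∀ v → adj v v ≡ false

open Graph public

Adj : ∀ {n} → Graph n → Fin n → Fin n → Set
Adj G u v = T (adj G u v)

IsClique : ∀ {n} → Graph n → Subset n → Set
IsClique G C = ∀ u v → u ∈ C → v ∈ C → u ≢ v → Adj G u v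

IsIndependent : ∀ {n} → Graph n → Subset n → Set
IsIndependent G I = ∀ u v → u ∈ I → v ∈ I → ¬ Adj G u v

IsMaximumClique : ∀ {n} → Graph n → Subset n → Set
IsMaximumClique G K = IsClique G K × (∀ C → IsClique G C → ∣ C ∣ ≤ ∣ K ∣)

-- G = (S ∪ K, E) is split with respect to the partition (S, K) of the vertex set
-- given by K; S is the complement of K (vertices v with v ∉ K).
IsSplitPartition : ∀ {n} → Graph n → Subset n → Set
IsSplitPartition G K =
  IsClique G K × (∀ u v → u ∉ K → v ∉ K → ¬ Adj G u v)

-- A partition of V(G) into k nonempty parts V_0,...,V_{k-1} is represented by a
-- surjective part-assignment f : Fin n → Fin k  (V_i = f⁻¹(i)).
IsPartition : ∀ {n k} → (Fin n → Fin k) → Set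
IsPartition f = Surjective _≡_ _≡_ f

Dominates : ∀ {n k} → Graph n → (Fin n → Fin k) → Fin k → Fin k → Set
Dominates G f i j = ∀ v → f v ≡ j → ∃ λ u → f u ≡ i × Adj G u v

IsTransitivePartition : ∀ {n k} → Graph n → (Fin n → Fin k) → Set
IsTransitivePartition G f =
  IsPartition f × (∀ i j → i <ᶠ j → Dominates G f i j)

IsUpperDomaticPartition : ∀ {n k} → Graph n → (Fin n → Fin k) → Set
IsUpperDomaticPartition G f =
  IsPartition f × (∀ i j → i ≢ j → Dominates G f i j ⊎ Dominates G f j i)

HasTransitivePartition : ∀ {n} → Graph n → ℕ → Set
HasTransitivePartition G k = Σ (Fin _ → Fin k) (IsTransitivePartition G)

HasUpperDomaticPartition : ∀ {n} → Graph n → ℕ → Set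
HasUpperDomaticPartition G k = Σ (Fin _ → Fin k) (IsUpperDomaticPartition G)

IsMaxOf : (ℕ → Set) → ℕ → Set
IsMaxOf P k = P k × (∀ m → P m → m ≤ k)

IsTransitivity : ∀ {n} → Graph n → ℕ → Set
IsTransitivity G = IsMaxOf (HasTransitivePartition G)

IsUpperDomaticNumber : ∀ {n} → Graph n → ℕ → Set
IsUpperDomaticNumber G = IsMaxOf (HasUpperDomaticPartition G)

{-# OPTIONS --safe #-}
-- Let S be the complement of K. Since S is independent, two parts of an upper domatic
-- partition that avoid K cannot dominate each other, so at most one part avoids K and
-- D(G) ≤ |K| + 1. If some v₀ ∈ K has no neighbour in S, a part P avoiding K cannot dominate
-- the part of v₀, so the part of v₀ dominates P and hence contains a second vertex of K;
-- moving v₀ into P makes every part meet K, whence D(G) ≤ |K|. Conversely, singleton parts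
-- for the vertices of K, with S joining the first of them (K ≠ ∅ by maximality), form a
-- transitive partition; when S ≠ ∅ and every vertex of K has a neighbour in S, S can instead
-- be a part of its own in front, giving |K| + 1 parts. As Tr(G) ≤ D(G), both are equal.
module Submission where

open import Defs hiding (sym)
open import Data.Nat using (ℕ; suc; _≤_; _<_)
open import Data.Nat.Properties using (n≮0)
open import Data.Bool using (T)
open import Data.Fin using (Fin; zero; suc; _≟_; toℕ; fromℕ<) renaming (_<_ to _<ᶠ_)
open import Data.Fin.Properties using (any?; injective⇒≤; suc-injective; toℕ-fromℕ<; <-cmp; <⇒≢)
open import Data.Fin.Subset using (Subset; _∈_; _∉_; ∣_∣; ⁅_⁆; inside; outside)
open import Data.Fin.Subset.Properties using (_∈?_; x∈⁅y⁆⇒x≡y; ∣⁅x⁆∣≡1)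
open import Data.Vec.Base using (_∷_; here; there)
open import Data.Product using (∃; _×_; _,_; proj₁; proj₂)
open import Data.Sum using (_⊎_; inj₁; inj₂)
open import Function using (_∘_)
open import Function.Definitions using (Injective; StrictlySurjective)
open import Function.Consequences.Propositional
  using (strictlySurjective⇒surjective; surjective⇒strictlySurjective)
open import Relation.Binary.Definitions using (tri<; tri≈; tri>)
open import Relation.Binary.PropositionalEquality using (_≡_; _≢_; refl; sym; trans; cong; subst)
open import Relation.Nullary using (¬_; Dec; yes; no; contradiction)
open import Relation.Nullary.Decidable using (¬?; _×-dec_; T?; decidable-stable)

enum : ∀ {n} (p : Subset n) → Fin ∣ p ∣ → Fin n
enum (inside  ∷ p) zero    = zero
enum (inside  ∷ p) (suc j) = suc (enum p j)
enum (outside ∷ p) j       = suc (enum p j)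

enum-∈ : ∀ {n} (p : Subset n) j → enum p j ∈ p
enum-∈ (inside  ∷ p) zero    = here
enum-∈ (inside  ∷ p) (suc j) = there (enum-∈ p j)
enum-∈ (outside ∷ p) j       = there (enum-∈ p j)

enum-injective : ∀ {n} (p : Subset n) → Injective _≡_ _≡_ (enum p)
enum-injective (inside  ∷ p) {zero}  {zero}  _  = refl
enum-injective (inside  ∷ p) {suc i} {suc j} eq = cong suc (enum-injective p (suc-injective eq))
enum-injective (outside ∷ p)                 eq = enum-injective p (suc-injective eq)

rank : ∀ {n} (p : Subset n) {v} → v ∈ p → Fin ∣ p ∣
rank (inside  ∷ p) here        = zero
rank (inside  ∷ p) (there v∈p) = suc (rank p v∈p)
rank (outside ∷ p) (there v∈p) = rank p v∈p

enum-rank : ∀ {n} (p : Subset n) {v} (v∈p : v ∈ p) → enum p (rank p v∈p) ≡ v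
enum-rank (inside  ∷ p) here        = refl
enum-rank (inside  ∷ p) (there v∈p) = cong suc (enum-rank p v∈p)
enum-rank (outside ∷ p) (there v∈p) = cong suc (enum-rank p v∈p)

rank-enum : ∀ {n} (p : Subset n) j (j∈p : enum p j ∈ p) → rank p j∈p ≡ j
rank-enum p j j∈p = enum-injective p (enum-rank p j∈p)

rank-injective : ∀ {n} (p : Subset n) {v w} (v∈p : v ∈ p) (w∈p : w ∈ p) →
                 rank p v∈p ≡ rank p w∈p → v ≡ w
rank-injective p v∈p w∈p eq =
  trans (sym (enum-rank p v∈p)) (trans (cong (enum p) eq) (enum-rank p w∈p))

rankOrZero : ∀ {n} (p : Subset n) → Fin n → Fin (suc ∣ p ∣)
rankOrZero p v with v ∈? p
... | yes v∈p = suc (rank p v∈p)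
... | no  _   = zero

rankOrZero-∉ : ∀ {n} (p : Subset n) {v} → v ∉ p → rankOrZero p v ≡ zero
rankOrZero-∉ p {v} v∉p with v ∈? p
... | yes v∈p = contradiction v∈p v∉p
... | no  _   = refl

rankOrZero-enum : ∀ {n} (p : Subset n) j → rankOrZero p (enum p j) ≡ suc j
rankOrZero-enum p j with enum p j ∈? p
... | yes j∈p = cong suc (rank-enum p j j∈p)
... | no  j∉p = contradiction (enum-∈ p j) j∉p

rankOrZero-suc : ∀ {n} (p : Subset n) {v j} → rankOrZero p v ≡ suc j → v ≡ enum p j
rankOrZero-suc p {v} eq with v ∈? p
... | yes v∈p = trans (sym (enum-rank p v∈p)) (cong (enum p) (suc-injective eq))

injection-into⇒≤ : ∀ {m n} {p : Subset n} (φ : Fin m → Fin n) →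
                   (∀ i → φ i ∈ p) → Injective _≡_ _≡_ φ → m ≤ ∣ p ∣
injection-into⇒≤ {p = p} φ φ∈p φ-injective =
  injective⇒≤ (λ eq → φ-injective (rank-injective p (φ∈p _) (φ∈p _) eq))

Meets : ∀ {n m} → (Fin n → Fin m) → Subset n → Fin m → Set
Meets f p i = ∃ λ v → v ∈ p × f v ≡ i

meets? : ∀ {n m} (f : Fin n → Fin m) p i → Dec (Meets f p i)
meets? f p i = any? λ v → (v ∈? p) ×-dec (f v ≟ i)

all-meet⇒≤ : ∀ {n m} (f : Fin n → Fin m) {p} → (∀ i → Meets f p i) → m ≤ ∣ p ∣
all-meet⇒≤ f meets = injection-into⇒≤ (proj₁ ∘ meets) (proj₁ ∘ proj₂ ∘ meets)
  λ {i} {j} eq → trans (sym (f-rep i)) (trans (cong f eq) (f-rep j))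
  where
  f-rep : ∀ i → f (proj₁ (meets i)) ≡ i
  f-rep = proj₂ ∘ proj₂ ∘ meets

all-but-one-meet⇒≤ : ∀ {n m} (f : Fin n → Fin m) {p} →
                     (∀ i j → ¬ Meets f p i → ¬ Meets f p j → i ≡ j) → m ≤ suc ∣ p ∣
all-but-one-meet⇒≤ f {p} avoiders-equal =
  injective⇒≤ (λ {i} {j} → code-injective (meets? f p i) (meets? f p j))
  where
  code : ∀ {i} → Dec (Meets f p i) → Fin (suc ∣ p ∣)
  code (yes (_ , v∈p , _)) = suc (rank p v∈p)
  code (no _)              = zero

  code-injective : ∀ {i j} (mi : Dec (Meets f p i)) (mj : Dec (Meets f p j)) →
                   code mi ≡ code mj → i ≡ j
  code-injective (yes (v , v∈p , fv≡i)) (yes (w , w∈p , fw≡j)) eq =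
    trans (sym fv≡i) (trans (cong f (rank-injective p v∈p w∈p (suc-injective eq))) fw≡j)
  code-injective (no ¬mi) (no ¬mj) _ = avoiders-equal _ _ ¬mi ¬mj

relocate : ∀ {n m} → (Fin n → Fin m) → Fin n → Fin m → Fin n → Fin m
relocate f v₀ a v with v ≟ v₀
... | yes _ = a
... | no  _ = f v

relocate-here : ∀ {n m} (f : Fin n → Fin m) v₀ a → relocate f v₀ a v₀ ≡ a
relocate-here f v₀ a with v₀ ≟ v₀
... | yes _    = refl
... | no v₀≢v₀ = contradiction refl v₀≢v₀

relocate-there : ∀ {n m} (f : Fin n → Fin m) {v₀} a {v} → v ≢ v₀ → relocate f v₀ a v ≡ f v
relocate-there f {v₀} a {v} v≢v₀ with v ≟ v₀
... | yes v≡v₀ = contradiction v≡v₀ v≢v₀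
... | no  _    = refl

-- Moving v₀ into the part a makes every part meet p: a gains v₀, and the part of v₀ keeps u.
all-but-one-meet∧collision⇒≤ : ∀ {n m} (f : Fin n → Fin m) {p} a →
  (∀ i → i ≢ a → Meets f p i) →
  ∀ {u v₀} → u ∈ p → v₀ ∈ p → u ≢ v₀ → f u ≡ f v₀ → m ≤ ∣ p ∣
all-but-one-meet∧collision⇒≤ f {p} a meets {u} {v₀} u∈p v₀∈p u≢v₀ fu≡fv₀ =
  all-meet⇒≤ (relocate f v₀ a) meets′
  where
  meets′ : ∀ i → Meets (relocate f v₀ a) p i
  meets′ i with i ≟ a
  ... | yes refl = v₀ , v₀∈p , relocate-here f v₀ a
  ... | no i≢a with meets i i≢a
  ...   | w , w∈p , fw≡i with w ≟ v₀
  ...     | yes refl = u , u∈p , trans (relocate-there f a u≢v₀) (trans fu≡fv₀ fw≡i)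
  ...     | no w≢v₀  = w , w∈p , trans (relocate-there f a w≢v₀) fw≡i

Adj-sym : ∀ {n} (G : Graph n) {u v} → Adj G u v → Adj G v u
Adj-sym G {u} {v} = subst T (Graph.sym G u v)

transitive⇒upperDomatic : ∀ {n k} {G : Graph n} {f : Fin n → Fin k} →
                          IsTransitivePartition G f → IsUpperDomaticPartition G f
transitive⇒upperDomatic {G = G} {f} (surjective , dominates) = surjective , comparable
  where
  comparable : ∀ i j → i ≢ j → Dominates G f i j ⊎ Dominates G f j i
  comparable i j i≢j with <-cmp i j
  ... | tri< i<j _   _   = inj₁ (dominates i j i<j)
  ... | tri≈ _   i≡j _   = contradiction i≡j i≢j
  ... | tri> _   _   j<i = inj₂ (dominates j i j<i)

isUpperDomaticNumber∧isTransitivity : ∀ {n k} (G : Graph n) → HasTransitivePartition G k →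
  (∀ m → HasUpperDomaticPartition G m → m ≤ k) →
  IsUpperDomaticNumber G k × IsTransitivity G k
isUpperDomaticNumber∧isTransitivity G transitive bound =
  (upperDomatic transitive , bound) , (transitive , λ m t → bound m (upperDomatic t))
  where
  upperDomatic : ∀ {m} → HasTransitivePartition G m → HasUpperDomaticPartition G m
  upperDomatic (f , t) = f , transitive⇒upperDomatic {G = G} t

⁅⁆-isClique : ∀ {n} (G : Graph n) v → IsClique G ⁅ v ⁆
⁅⁆-isClique G v u w u∈ w∈ u≢w =
  contradiction (trans (x∈⁅y⁆⇒x≡y v u∈) (sym (x∈⁅y⁆⇒x≡y v w∈))) u≢w

maximumClique-nonempty : ∀ {n} (G : Graph n) K → IsMaximumClique G K → Fin n → 0 < ∣ K ∣
maximumClique-nonempty G K (_ , maximum) v =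
  subst (_≤ ∣ K ∣) (∣⁅x⁆∣≡1 v) (maximum ⁅ v ⁆ (⁅⁆-isClique G v))

module SplitGraph {n} (G : Graph n) (K : Subset n) (split : IsSplitPartition G K) where

  HasOuterNeighbour : Fin n → Set
  HasOuterNeighbour v = ∃ λ u → u ∉ K × Adj G u v

  hasOuterNeighbour? : ∀ v → Dec (HasOuterNeighbour v)
  hasOuterNeighbour? v = any? λ u → ¬? (u ∈? K) ×-dec T? (adj G u v)

  Lonely : Fin n → Set
  Lonely v = v ∈ K × ¬ HasOuterNeighbour v

  neighbour-of-outer-∈ : ∀ {u v} → u ∉ K → Adj G v u → v ∈ K
  neighbour-of-outer-∈ {u} {v} u∉K vu =
    decidable-stable (v ∈? K) λ v∉K → proj₂ split v u v∉K u∉K vu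

  enum-adjacent : ∀ {i j} → i ≢ j → Adj G (enum K i) (enum K j)
  enum-adjacent {i} {j} i≢j =
    proj₁ split _ _ (enum-∈ K i) (enum-∈ K j) (i≢j ∘ enum-injective K)

  module UpperDomatic {m} (f : Fin n → Fin m) (upperDomatic : IsUpperDomaticPartition G f) where

    part-nonempty : ∀ i → ∃ λ v → f v ≡ i
    part-nonempty = surjective⇒strictlySurjective (proj₁ upperDomatic)

    ¬dominates-avoiding : ∀ {i j} → ¬ Meets f K i → ¬ Meets f K j → ¬ Dominates G f i j
    ¬dominates-avoiding {i} {j} ¬mi ¬mj i→j =
      let s , fs≡j      = part-nonempty j
          u , fu≡i , us = i→j s fs≡j
      in proj₂ split u s (λ u∈K → ¬mi (u , u∈K , fu≡i)) (λ s∈K → ¬mj (s , s∈K , fs≡j)) us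

    avoiding-parts-equal : ∀ i j → ¬ Meets f K i → ¬ Meets f K j → i ≡ j
    avoiding-parts-equal i j ¬mi ¬mj with i ≟ j
    ... | yes i≡j = i≡j
    ... | no  i≢j with proj₂ upperDomatic i j i≢j
    ...   | inj₁ i→j = contradiction i→j (¬dominates-avoiding ¬mi ¬mj)
    ...   | inj₂ j→i = contradiction j→i (¬dominates-avoiding ¬mj ¬mi)

    ≤suc∣K∣ : m ≤ suc ∣ K ∣
    ≤suc∣K∣ = all-but-one-meet⇒≤ f avoiding-parts-equal

    lonely-collision : ∀ {p v₀} → ¬ Meets f K p → Lonely v₀ →
                       ∃ λ u → u ∈ K × u ≢ v₀ × f u ≡ f v₀
    lonely-collision {p} {v₀} ¬mp (v₀∈K , ¬outer) with proj₂ upperDomatic p (f v₀) p≢fv₀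
      where
      p≢fv₀ : p ≢ f v₀
      p≢fv₀ p≡fv₀ = ¬mp (v₀ , v₀∈K , sym p≡fv₀)
    ... | inj₁ p→fv₀ =
      let u , fu≡p , uv₀ = p→fv₀ v₀ refl
      in contradiction (u , (λ u∈K → ¬mp (u , u∈K , fu≡p)) , uv₀) ¬outer
    ... | inj₂ fv₀→p =
      let s , fs≡p        = part-nonempty p
          u , fu≡fv₀ , us = fv₀→p s fs≡p
          s∉K : s ∉ K
          s∉K s∈K = ¬mp (s , s∈K , fs≡p)
      in u , neighbour-of-outer-∈ s∉K us
           , (λ u≡v₀ → ¬outer (s , s∉K , Adj-sym G (subst (λ w → Adj G w s) u≡v₀ us)))
           , fu≡fv₀

    ≤∣K∣ : (∀ s → s ∉ K → ∃ Lonely) → m ≤ ∣ K ∣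
    ≤∣K∣ lonely-exists with any? (λ i → ¬? (meets? f K i))
    ... | no ¬avoiding = all-meet⇒≤ f λ i →
      decidable-stable (meets? f K i) (λ ¬mi → ¬avoiding (i , ¬mi))
    ... | yes (p , ¬mp) =
      let s , fs≡p                = part-nonempty p
          v₀ , v₀-lonely          = lonely-exists s (λ s∈K → ¬mp (s , s∈K , fs≡p))
          u , u∈K , u≢v₀ , fu≡fv₀ = lonely-collision ¬mp v₀-lonely
      in all-but-one-meet∧collision⇒≤ f p meets-unless-p u∈K (proj₁ v₀-lonely) u≢v₀ fu≡fv₀
      where
      meets-unless-p : ∀ i → i ≢ p → Meets f K i
      meets-unless-p i i≢p =
        decidable-stable (meets? f K i) (λ ¬mi → i≢p (avoiding-parts-equal i p ¬mi ¬mp))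

  transitive-suc∣K∣ : (∃ λ s → s ∉ K) → (∀ v → v ∈ K → HasOuterNeighbour v) →
                      HasTransitivePartition G (suc ∣ K ∣)
  transitive-suc∣K∣ (s , s∉K) outer =
    rankOrZero K , strictlySurjective⇒surjective onto , dominates
    where
    onto : StrictlySurjective _≡_ (rankOrZero K)
    onto zero    = s , rankOrZero-∉ K s∉K
    onto (suc j) = enum K j , rankOrZero-enum K j

    dominates : ∀ i j → i <ᶠ j → Dominates G (rankOrZero K) i j
    dominates zero (suc j) _ v v↦j =
      let u , u∉K , uv = outer v (subst (_∈ K) (sym (rankOrZero-suc K v↦j)) (enum-∈ K j))
      in u , rankOrZero-∉ K u∉K , uv
    dominates (suc i) (suc j) i<j v v↦j =
      enum K i , rankOrZero-enum K i ,
      subst (Adj G (enum K i)) (sym (rankOrZero-suc K v↦j))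
        (enum-adjacent (λ i≡j → <⇒≢ i<j (cong suc i≡j)))

  transitive-∣K∣ : (Fin n → 0 < ∣ K ∣) → HasTransitivePartition G ∣ K ∣
  transitive-∣K∣ nonempty = f , strictlySurjective⇒surjective onto , dominates
    where
    collapse : 0 < ∣ K ∣ → Fin (suc ∣ K ∣) → Fin ∣ K ∣
    collapse 0<∣K∣ zero    = fromℕ< 0<∣K∣
    collapse _     (suc j) = j

    f : Fin n → Fin ∣ K ∣
    f v = collapse (nonempty v) (rankOrZero K v)

    onto : StrictlySurjective _≡_ f
    onto j = enum K j , cong (collapse _) (rankOrZero-enum K j)

    dominates : ∀ i j → i <ᶠ j → Dominates G f i j
    dominates i j i<j v v↦j with rankOrZero K v in v↦
    ... | zero   = -- v is outer, so it lies in part 0, which no part precedes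
      contradiction (subst (toℕ i <_) (trans (cong toℕ (sym v↦j)) (toℕ-fromℕ< _)) i<j) n≮0
    ... | suc j′ =
      enum K i , proj₂ (onto i) ,
      subst (Adj G (enum K i)) (sym (rankOrZero-suc K v↦))
        (enum-adjacent (λ i≡j′ → <⇒≢ i<j (trans i≡j′ v↦j)))

theorem3 : ∀ {n} (G : Graph n) (K : Subset n) →
    IsSplitPartition G K → IsMaximumClique G K →
    ∃ λ k → IsUpperDomaticNumber G k × IsTransitivity G k
theorem3 {n} G K split maximum =
  cases (any? λ v → (v ∈? K) ×-dec ¬? (hasOuterNeighbour? v)) (any? λ s → ¬? (s ∈? K))
  where
  open SplitGraph G K split

  D≡Tr : ℕ → Set
  D≡Tr k = IsUpperDomaticNumber G k × IsTransitivity G k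

  ∣K∣-parts : (∀ s → s ∉ K → ∃ Lonely) → ∃ D≡Tr
  ∣K∣-parts lonely-exists =
    ∣ K ∣ , isUpperDomaticNumber∧isTransitivity G
              (transitive-∣K∣ (maximumClique-nonempty G K maximum))
              (λ _ (f , upperDomatic) → UpperDomatic.≤∣K∣ f upperDomatic lonely-exists)

  cases : Dec (∃ Lonely) → Dec (∃ λ s → s ∉ K) → ∃ D≡Tr
  cases (yes lonely)  _                 = ∣K∣-parts λ _ _ → lonely
  cases (no _)        (no noOuter)      = ∣K∣-parts λ s s∉K → contradiction (s , s∉K) noOuter
  cases (no noLonely) (yes outerVertex) =
    suc ∣ K ∣ , isUpperDomaticNumber∧isTransitivity G
                  (transitive-suc∣K∣ outerVertex allOuter)
                  (λ _ (f , upperDomatic) → UpperDomatic.≤suc∣K∣ f upperDomatic)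
    where
    allOuter : ∀ v → v ∈ K → HasOuterNeighbour v
    allOuter v v∈K =
      decidable-stable (hasOuterNeighbour? v) λ ¬outer → noLonely (v , v∈K , ¬outer)
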